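{- Let $\mathbf{d}=(d_1,\dots,d_n)$ be a non-increasing degree sequence, let $1\le h< n$ be the number of heavy vertices, and let $m_t,m_d,m_l\ge 0$ be integers. Let $\mathcal{S}$ be the class of multigraphs on $\{1,\dots,n\}$ with degree sequence $\mathbf{d}$ that contain exactly $m_t$ light triple-edges, exactly $m_d$ light double-edges and exactly $m_l$ light single loops, and no other non-simple edges. Define $$\underline{b}_l(\mathcal{S};0)=L_2-12m_t d_h-8m_d d_h-m_l d_h^2,\qquad \underline{b}_l(\mathcal{S};1)=M_1-6m_t-4m_d-2m_l-2A_2-4d_1-2d_h .$$ Then for every $G\in\mathcal{S}$ we have $\underline{b}_l(\mathcal{S};0)\le b_l(G,\emptyset)$, and for every light simple two-star $v_1v_2v_3$ in $G$ that is created by a valid $l$-switching producing $G$, we have $\underline{b}_l(\mathcal{S};1)\le b_l(G,v_1v_2v_3)$.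
   Context: Multigraphs may contain loops and multiple edges; a loop at $i$ contributes $2$ to the degree of $i$, and $m_{i,j}$ denotes the multiplicity of edge $ij$ (an edge of multiplicity $m$ is regarded as $m$ pairs $(i,j)$). An edge $ij$ with $i\neq j$ and $m_{i,j}=1,2,3$ is a single-, double-, triple-edge; a loop with $m_{i,i}=1$ is a single loop. An edge is simple if it is a single-edge that is not a loop. The vertices $1,\dots,h$ (the $h$ highest-degree vertices) are heavy and the others are light; a multi-edge or loop is light if it is incident to at least one light vertex. Notation: $[x]_k=\prod_{j=0}^{k-1}(x-j)$; $M_k=\sum_{i=1}^n [d_i]_k$, $H_k=\sum_{i=1}^h[d_i]_k$, $L_k=M_k-H_k$; $A_2=\sum_{i=1}^{d_1} d_i$; $d_h$ denotes the $h$-th entry of $\mathbf{d}$. A light simple ordered two-star is an ordered triple $(v_1,v_2,v_3)$ of distinct vertices with $v_1$ light and $v_1v_2$, $v_1v_3$ simple edges; it is written $v_1v_2v_3$. A simple ordered pair is an ordered pair $(u,w)$ such that $uw$ is a simple edge. $b_l(G,\emptyset)$ is the number of light simple ordered two-stars in $G$. For a two-star $v_1v_2v_3$, $b_l(G,v_1v_2v_3)$ is the number of simple ordered pairs $(v_4,v_5)$ in $G$ with $v_4,v_5\notin\{v_1,v_2,v_3\}$ such that $v_2v_4$ and $v_3v_5$ are non-edges of $G$. An $l$-switching takes a multigraph $G_0$ with the same degree sequence having a loop at $v_1$ and pairs $(v_2,v_4)$, $(v_3,v_5)$, and replaces the pairs $(v_1,v_1),(v_2,v_4),(v_3,v_5)$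 by $(v_1,v_2),(v_1,v_3),(v_4,v_5)$, producing $G$; it is valid if it removes this loop without adding or removing any other multi-edges or loops. The two-star created by it is $v_1v_2v_3$. -}

module Defs where

open import Data.Nat as ℕ using (ℕ; zero; suc; _+_; _*_; _∸_; _≤_; _<_; _≤?_; _<?_)
open import Data.Fin as Fin using (Fin; toℕ)
open import Data.Integer as ℤ using (ℤ; +_)
open import Data.Product using (_×_; Σ; ∃-syntax; _,_)
open import Data.Sum using (_⊎_)
open import Relation.Nullary using (Dec; yes; no; ¬_)
open import Relation.Nullary.Decidable using (_×-dec_; _⊎-dec_; ¬?)
open import Relation.Binary.PropositionalEquality using (_≡_; _≢_)

sumFin : ∀ {n} → (Fin n → ℕ) → ℕ
sumFin {zero}  f = 0
sumFin {suc n} f = f Fin.zero + sumFin (λ i → f (Fin.suc i))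

ind : ∀ {p} {P : Set p} → Dec P → ℕ
ind (yes _) = 1
ind (no  _) = 0

-- entry d k = d_{k+1} (0-based access, 0 out of range)
entry : ∀ {n} → (Fin n → ℕ) → ℕ → ℕ
entry {zero}  d k       = 0
entry {suc n} d zero    = d Fin.zero
entry {suc n} d (suc k) = entry (λ i → d (Fin.suc i)) k

-- [x]_2 = x(x-1)  (equals 0 for x = 0, so truncated subtraction is harmless)
ff2 : ℕ → ℕ
ff2 x = x * (x ∸ 1)

-- Multigraphs on {1..n} (vertex i+1 is represented by i : Fin n).
-- mult i j = m_{i,j}; for i = j it is the number of loops at i.

record Multigraph (n : ℕ) : Set where
  field
    mult : Fin n → Fin n → ℕ
    symm : ∀ i j → mult i j ≡ mult j i
open Multigraph public

-- degree: a loop contributes 2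
deg : ∀ {n} → Multigraph n → Fin n → ℕ
deg G i = sumFin (λ j → mult G i j) + mult G i i

HasDegrees : ∀ {n} → Multigraph n → (Fin n → ℕ) → Set
HasDegrees G d = ∀ i → deg G i ≡ d i

NonIncreasing : ∀ {n} → (Fin n → ℕ) → Set
NonIncreasing d = ∀ i j → toℕ i ≤ toℕ j → d j ≤ d i

-- heavy vertices are 1..h, i.e. indices 0..h-1
Light : ℕ → ∀ {n} → Fin n → Set
Light h i = h ≤ toℕ i

light? : ∀ h {n} (i : Fin n) → Dec (Light h i)
light? h i = h ≤? toℕ i

countLightMulti : ∀ {n} → ℕ → Multigraph n → ℕ → ℕ
countLightMulti h G k =
  sumFin (λ i → sumFin (λ j →
    ind ((toℕ i <? toℕ j) ×-dec ((mult G i j ℕ.≟ k) ×-dec (light? h i ⊎-dec light? h j)))))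

countLightSingleLoops : ∀ {n} → ℕ → Multigraph n → ℕ
countLightSingleLoops h G = sumFin (λ i → ind (light? h i ×-dec (mult G i i ℕ.≟ 1)))

NoOtherNonSimple : ∀ {n} → ℕ → Multigraph n → Set
NoOtherNonSimple h G =
  (∀ i j → i ≢ j → 2 ≤ mult G i j →
     (Light h i ⊎ Light h j) × (mult G i j ≡ 2 ⊎ mult G i j ≡ 3))
  × (∀ i → 1 ≤ mult G i i → Light h i × mult G i i ≡ 1)

InS : ∀ {n} → (Fin n → ℕ) → ℕ → (mt md ml : ℕ) → Multigraph n → Set
InS d h mt md ml G =
  HasDegrees G d
  × countLightMulti h G 3 ≡ mt
  × countLightMulti h G 2 ≡ md
  × countLightSingleLoops h G ≡ ml
  × NoOtherNonSimple h G

SimpleEdge : ∀ {n} → Multigraph n → Fin n → Fin n → Set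
SimpleEdge G u w = u ≢ w × mult G u w ≡ 1

simpleEdge? : ∀ {n} (G : Multigraph n) u w → Dec (SimpleEdge G u w)
simpleEdge? G u w = ¬? (u Fin.≟ w) ×-dec (mult G u w ℕ.≟ 1)

LightSimpleTwoStar : ∀ {n} → ℕ → Multigraph n → Fin n → Fin n → Fin n → Set
LightSimpleTwoStar h G v1 v2 v3 =
  Light h v1 × v1 ≢ v2 × v1 ≢ v3 × v2 ≢ v3 × SimpleEdge G v1 v2 × SimpleEdge G v1 v3

lightSimpleTwoStar? : ∀ {n} h (G : Multigraph n) v1 v2 v3 → Dec (LightSimpleTwoStar h G v1 v2 v3)
lightSimpleTwoStar? h G v1 v2 v3 =
  light? h v1 ×-dec ¬? (v1 Fin.≟ v2) ×-dec ¬? (v1 Fin.≟ v3) ×-dec ¬? (v2 Fin.≟ v3)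
  ×-dec simpleEdge? G v1 v2 ×-dec simpleEdge? G v1 v3

bl∅ : ∀ {n} → ℕ → Multigraph n → ℕ
bl∅ h G = sumFin (λ v1 → sumFin (λ v2 → sumFin (λ v3 → ind (lightSimpleTwoStar? h G v1 v2 v3))))

blStar : ∀ {n} → Multigraph n → Fin n → Fin n → Fin n → ℕ
blStar G v1 v2 v3 = sumFin (λ v4 → sumFin (λ v5 → ind (
  simpleEdge? G v4 v5
  ×-dec ¬? (v4 Fin.≟ v1) ×-dec ¬? (v4 Fin.≟ v2) ×-dec ¬? (v4 Fin.≟ v3)
  ×-dec ¬? (v5 Fin.≟ v1) ×-dec ¬? (v5 Fin.≟ v2) ×-dec ¬? (v5 Fin.≟ v3)
  ×-dec (mult G v2 v4 ℕ.≟ 0) ×-dec (mult G v3 v5 ℕ.≟ 0))))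

-- one copy of the pair (a,b) as a contribution to the multiplicity matrix
-- (for a = b: one loop, i.e. +1 at (a,a))
pairAt : ∀ {n} → Fin n → Fin n → Fin n → Fin n → ℕ
pairAt a b i j = ind (((i Fin.≟ a) ×-dec (j Fin.≟ b)) ⊎-dec ((i Fin.≟ b) ×-dec (j Fin.≟ a)))

NonSimpleAt : ∀ {n} → Multigraph n → Fin n → Fin n → Set
NonSimpleAt G i j = (i ≡ j × 1 ≤ mult G i i) ⊎ 2 ≤ mult G i j

-- G is produced from G0 by the l-switching replacing (v1,v1),(v2,v4),(v3,v5)
-- by (v1,v2),(v1,v3),(v4,v5), and this switching is valid.
ValidLSwitching : ∀ {n} → (Fin n → ℕ) → Multigraph n → Multigraph n
                  → (v1 v2 v3 v4 v5 : Fin n) → Set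
ValidLSwitching d G0 G v1 v2 v3 v4 v5 =
  HasDegrees G0 d
  × 1 ≤ mult G0 v1 v1 × 1 ≤ mult G0 v2 v4 × 1 ≤ mult G0 v3 v5
  × (∀ i j → mult G i j + pairAt v1 v1 i j + pairAt v2 v4 i j + pairAt v3 v5 i j
             ≡ mult G0 i j + pairAt v1 v2 i j + pairAt v1 v3 i j + pairAt v4 v5 i j)
  -- validity: the loop at v1 is removed ...
  × mult G0 v1 v1 ≡ 1 × mult G v1 v1 ≡ 0
  -- ... and no other multi-edge or loop is added or removed (or altered)
  × (∀ i j → ¬ (i ≡ v1 × j ≡ v1) → (NonSimpleAt G0 i j ⊎ NonSimpleAt G i j)
             → mult G0 i j ≡ mult G i j)

CreatedByValidLSwitching : ∀ {n} → (Fin n → ℕ) → Multigraph n → (v1 v2 v3 : Fin n) → Set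
CreatedByValidLSwitching {n} d G v1 v2 v3 =
  Σ (Multigraph n) λ G0 → ∃[ v4 ] ∃[ v5 ] ValidLSwitching d G0 G v1 v2 v3 v4 v5

M1 : ∀ {n} → (Fin n → ℕ) → ℕ
M1 d = sumFin d

L2 : ∀ {n} → (Fin n → ℕ) → ℕ → ℕ
L2 d h = sumFin (λ i → ind (light? h i) * ff2 (d i))

A2 : ∀ {n} → (Fin n → ℕ) → ℕ
A2 d = sumFin (λ i → ind (toℕ i <? entry d 0) * d i)

d₁ : ∀ {n} → (Fin n → ℕ) → ℕ
d₁ d = entry d 0

dₕ : ∀ {n} → (Fin n → ℕ) → ℕ → ℕ
dₕ d h = entry d (h ∸ 1)

lowerBound0 : ∀ {n} → (Fin n → ℕ) → ℕ → (mt md ml : ℕ) → ℤ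
lowerBound0 d h mt md ml =
  + L2 d h ℤ.- + (12 * mt * dₕ d h) ℤ.- + (8 * md * dₕ d h) ℤ.- + (ml * (dₕ d h * dₕ d h))

lowerBound1 : ∀ {n} → (Fin n → ℕ) → ℕ → (mt md ml : ℕ) → ℤ
lowerBound1 d h mt md ml =
  + M1 d ℤ.- + (6 * mt) ℤ.- + (4 * md) ℤ.- + (2 * ml)
  ℤ.- + (2 * A2 d) ℤ.- + (4 * d₁ d) ℤ.- + (2 * dₕ d h)

{-# OPTIONS --safe #-}
module Submission where

-- Let s_v be the number of simple edges at v. Counting the edges at v, s_v is at
-- least d_v minus 3 per light triple-edge, 2 per light double-edge and 2 per light
-- single loop at v. A light vertex v is the centre of exactly [s_v]_2 light simple
-- two-stars, and [d_v]_2 exceeds [s_v]_2 by at most 2 d_h (d_v - s_v), or by at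
-- most d_h^2 if v carries a loop; summing over the light vertices gives the first
-- bound. There are at least M_1 - 6 m_t - 4 m_d - 2 m_l simple ordered pairs, and
-- such a pair (v4, v5) is not counted by b_l(G, v1v2v3) only if an end lies in
-- {v1, v2, v3} (at most 2 (d_{v1} + d_{v2} + d_{v3}) pairs) or if v2v4 or v3v5 is an
-- edge (at most A_2 pairs each, since v2 and v3 have at most d_1 neighbours).

open import Defs
open import Data.Nat using (ℕ; _≤_; _<_)
open import Data.Fin using (Fin)
open import Data.Integer using (+_) renaming (_≤_ to _≤ℤ_)
open import Data.Product using (_×_)

open import Data.Empty using (⊥-elim)
open import Data.Fin as Fin using (toℕ; inject₁)
import Data.Fin.Properties as Finₚ
open import Data.Integer as ℤ using (_-_; _⊖_)
import Data.Integer.Properties as ℤ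
open import Data.Nat as ℕ using (zero; suc; _+_; _*_; _∸_; z≤n; s≤s; s≤s⁻¹; _≤?_; _<?_)
open import Data.Nat.Properties
open import Data.Nat.Tactic.RingSolver using (solve-∀)
open import Algebra.Properties.Semiring.Sum +-*-semiring
  using (sum; sum-cong-≗; ∑-distrib-+; ∑-comm; *-distribˡ-sum; sum-init-last)
open import Data.Product using (_,_; proj₁)
open import Data.Sum as Sum using (_⊎_; inj₁; inj₂)
open import Function using (_∘_)
open import Relation.Binary.Definitions using (tri<; tri≈; tri>)
open import Relation.Binary.PropositionalEquality
open import Relation.Nullary using (Dec; yes; no; ¬_)
open import Relation.Nullary.Decidable using (_×-dec_; _⊎-dec_; ¬?)

module _ {a} {A : Set a} where

  ind-true : (x : Dec A) → A → ind x ≡ 1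
  ind-true (yes _) _ = refl
  ind-true (no ¬p) p = ⊥-elim (¬p p)

  ind-false : (x : Dec A) → ¬ A → ind x ≡ 0
  ind-false (yes p) ¬p = ⊥-elim (¬p p)
  ind-false (no _)  _  = refl

  ind≤1 : (x : Dec A) → ind x ≤ 1
  ind≤1 (yes _) = s≤s z≤n
  ind≤1 (no _)  = z≤n

  ind*-≤ : (x : Dec A) {m k : ℕ} → (A → m ≤ k) → ind x * m ≤ k
  ind*-≤ (yes p) {m} m≤k = ≤-trans (≤-reflexive (+-identityʳ m)) (m≤k p)
  ind*-≤ (no _)      _   = z≤n

  ind-excluded-middle : (x : Dec A) → 1 ≤ ind x + ind (¬? x)
  ind-excluded-middle (yes _) = s≤s z≤n
  ind-excluded-middle (no _)  = s≤s z≤n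

module _ {a b} {A : Set a} {B : Set b} where

  ind-cong : (x : Dec A) (y : Dec B) → (A → B) → (B → A) → ind x ≡ ind y
  ind-cong (yes p) y f g = sym (ind-true y (f p))
  ind-cong (no ¬p) y f g = sym (ind-false y (¬p ∘ g))

  -- Union bound for a conjunction, one conjunct at a time.
  1≤ind-×-dec : (x : Dec A) (y : Dec B) {r : ℕ} →
                1 ≤ ind y + r → 1 ≤ ind (x ×-dec y) + (ind (¬? x) + r)
  1≤ind-×-dec (yes _) (yes _) _  = s≤s z≤n
  1≤ind-×-dec (yes _) (no _)  1≤r = 1≤r
  1≤ind-×-dec (no _)  _       _  = s≤s z≤n

  1≤ind-¬?-×-dec : (x : Dec A) (y : Dec B) {r : ℕ} →
                   1 ≤ ind y + r → 1 ≤ ind (¬? x ×-dec y) + (ind x + r)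
  1≤ind-¬?-×-dec (yes _) _       _   = s≤s z≤n
  1≤ind-¬?-×-dec (no _)  (yes _) _   = s≤s z≤n
  1≤ind-¬?-×-dec (no _)  (no _)  1≤r = 1≤r

  ind≤ind-×-dec : (x : Dec A) (y : Dec B) {r : ℕ} →
                  1 ≤ ind y + r → ind x ≤ ind (x ×-dec y) + r * ind x
  ind≤ind-×-dec (yes _) (yes _)     _   = s≤s z≤n
  ind≤ind-×-dec (yes _) (no _)  {r} 1≤r = ≤-trans 1≤r (≤-reflexive (sym (*-identityʳ r)))
  ind≤ind-×-dec (no _)  _           _   = z≤n

sumFin≡sum : ∀ {n} (f : Fin n → ℕ) → sumFin f ≡ sum f
sumFin≡sum {zero}  f = refl
sumFin≡sum {suc n} f = cong (_+_ (f Fin.zero)) (sumFin≡sum (f ∘ Fin.suc))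

sumFin-cong : ∀ {n} {f g : Fin n → ℕ} → (∀ i → f i ≡ g i) → sumFin f ≡ sumFin g
sumFin-cong {f = f} {g} f≗g =
  trans (sumFin≡sum f) (trans (sum-cong-≗ f≗g) (sym (sumFin≡sum g)))

sumFin-mono : ∀ {n} {f g : Fin n → ℕ} → (∀ i → f i ≤ g i) → sumFin f ≤ sumFin g
sumFin-mono {zero}  f≤g = z≤n
sumFin-mono {suc n} f≤g = +-mono-≤ (f≤g Fin.zero) (sumFin-mono (f≤g ∘ Fin.suc))

sumFin-distrib-+ : ∀ {n} (f g : Fin n → ℕ) →
                   sumFin (λ i → f i + g i) ≡ sumFin f + sumFin g
sumFin-distrib-+ f g = begin
  sumFin (λ i → f i + g i) ≡⟨ sumFin≡sum (λ i → f i + g i) ⟩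
  sum (λ i → f i + g i)    ≡⟨ ∑-distrib-+ f g ⟩
  sum f + sum g            ≡⟨ cong₂ _+_ (sumFin≡sum f) (sumFin≡sum g) ⟨
  sumFin f + sumFin g      ∎
  where open ≡-Reasoning

*-distribˡ-sumFin : ∀ {n} c (f : Fin n → ℕ) → c * sumFin f ≡ sumFin (λ i → c * f i)
*-distribˡ-sumFin c f = begin
  c * sumFin f         ≡⟨ cong (c *_) (sumFin≡sum f) ⟩
  c * sum f            ≡⟨ *-distribˡ-sum c f ⟩
  sum (λ i → c * f i)  ≡⟨ sumFin≡sum (λ i → c * f i) ⟨
  sumFin (λ i → c * f i) ∎
  where open ≡-Reasoning

sumFin-linear : ∀ {n} a b (f g : Fin n → ℕ) →
                sumFin (λ i → a * f i + b * g i) ≡ a * sumFin f + b * sumFin g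
sumFin-linear a b f g = trans (sumFin-distrib-+ (λ i → a * f i) (λ i → b * g i))
  (sym (cong₂ _+_ (*-distribˡ-sumFin a f) (*-distribˡ-sumFin b g)))

sumFin-comm : ∀ {m n} (f : Fin m → Fin n → ℕ) →
              sumFin (λ i → sumFin (f i)) ≡ sumFin (λ j → sumFin (λ i → f i j))
sumFin-comm f = begin
  sumFin (λ i → sumFin (f i))             ≡⟨ sumFin-cong (λ i → sumFin≡sum (f i)) ⟩
  sumFin (λ i → sum (f i))                ≡⟨ sumFin≡sum (λ i → sum (f i)) ⟩
  sum (λ i → sum (f i))                   ≡⟨ ∑-comm f ⟩
  sum (λ j → sum (λ i → f i j))           ≡⟨ sumFin≡sum (λ j → sum (λ i → f i j)) ⟨
  sumFin (λ j → sum (λ i → f i j))        ≡⟨ sumFin-cong (λ j → sumFin≡sum (λ i → f i j)) ⟨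
  sumFin (λ j → sumFin (λ i → f i j))     ∎
  where open ≡-Reasoning

sumFin₂-distrib-+ : ∀ {m n} (f g : Fin m → Fin n → ℕ) →
                    sumFin (λ i → sumFin (λ j → f i j + g i j))
                    ≡ sumFin (λ i → sumFin (f i)) + sumFin (λ i → sumFin (g i))
sumFin₂-distrib-+ f g = trans (sumFin-cong (λ i → sumFin-distrib-+ (f i) (g i)))
                              (sumFin-distrib-+ (λ i → sumFin (f i)) (λ i → sumFin (g i)))

sumFin-init≤ : ∀ {n} (f : Fin (suc n) → ℕ) → sumFin (f ∘ inject₁) ≤ sumFin f
sumFin-init≤ f = begin
  sumFin (f ∘ inject₁)                    ≡⟨ sumFin≡sum (f ∘ inject₁) ⟩
  sum (f ∘ inject₁)                       ≤⟨ m≤m+n _ _ ⟩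
  sum (f ∘ inject₁) + f (Fin.fromℕ _)     ≡⟨ sum-init-last f ⟨
  sum f                                   ≡⟨ sumFin≡sum f ⟨
  sumFin f                                ∎
  where open ≤-Reasoning

sumFin-zero : ∀ {n} (f : Fin n → ℕ) → (∀ i → f i ≡ 0) → sumFin f ≡ 0
sumFin-zero {zero}  f f≗0 = refl
sumFin-zero {suc n} f f≗0 = cong₂ _+_ (f≗0 Fin.zero) (sumFin-zero (f ∘ Fin.suc) (f≗0 ∘ Fin.suc))

sumFin-ind-≟ : ∀ {n} (a : Fin n) (f : Fin n → ℕ) → sumFin (λ i → ind (i Fin.≟ a) * f i) ≡ f a
sumFin-ind-≟ {suc n} Fin.zero f = trans
  (cong₂ _+_ (+-identityʳ (f Fin.zero))
             (sumFin-zero (λ i → ind (Fin.suc i Fin.≟ Fin.zero) * f (Fin.suc i)) (λ _ → refl)))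
  (+-identityʳ (f Fin.zero))
sumFin-ind-≟ {suc n} (Fin.suc a) f = trans
  (sumFin-cong (λ i → cong (_* f (Fin.suc i))
    (ind-cong (Fin.suc i Fin.≟ Fin.suc a) (i Fin.≟ a) Finₚ.suc-injective (cong Fin.suc))))
  (sumFin-ind-≟ a (f ∘ Fin.suc))

-- Sums of the largest entries of a non-increasing sequence

topSum : ∀ {n} → (Fin n → ℕ) → ℕ → ℕ
topSum d k = sumFin (λ i → ind (toℕ i <? k) * d i)

nonIncreasing-tail : ∀ {n} {d : Fin (suc n) → ℕ} → NonIncreasing d → NonIncreasing (d ∘ Fin.suc)
nonIncreasing-tail d↓ i j i≤j = d↓ (Fin.suc i) (Fin.suc j) (s≤s i≤j)

topSum-tail≤ : ∀ {n} {d : Fin (suc n) → ℕ} k → NonIncreasing d → topSum (d ∘ Fin.suc) k ≤ topSum d k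
topSum-tail≤ {n} {d} k d↓ = begin
  sumFin (λ i → ind (toℕ i <? k) * d (Fin.suc i))
    ≤⟨ sumFin-mono (λ i → *-mono-≤ (≤-reflexive (cong (λ m → ind (m <? k)) (sym (Finₚ.toℕ-inject₁ i))))
                                    (d↓ (inject₁ i) (Fin.suc i) (≤-trans (≤-reflexive (Finₚ.toℕ-inject₁ i)) (n≤1+n _)))) ⟩
  sumFin (λ i → ind (toℕ (inject₁ i) <? k) * d (inject₁ i))
    ≤⟨ sumFin-init≤ (λ i → ind (toℕ i <? k) * d i) ⟩
  topSum d k ∎
  where open ≤-Reasoning

topSum-suc : ∀ {n} (d : Fin (suc n) → ℕ) k →
             topSum d (suc k) ≡ d Fin.zero + topSum (d ∘ Fin.suc) k
topSum-suc d k = cong₂ _+_ (+-identityʳ (d Fin.zero)) (sumFin-cong (λ i →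
  cong (_* d (Fin.suc i)) (ind-cong (suc (toℕ i) <? suc k) (toℕ i <? k) s≤s⁻¹ s≤s)))

weighted≤topSum : ∀ {n} {d : Fin n → ℕ} {k} → NonIncreasing d → (w : Fin n → ℕ) →
                  (∀ i → w i ≤ 1) → sumFin w ≤ k → sumFin (λ i → w i * d i) ≤ topSum d k
weighted≤topSum {zero} _ _ _ _ = z≤n
weighted≤topSum {suc n} {d} {k} d↓ w w≤1 Σw≤k with w Fin.zero | w≤1 Fin.zero
... | zero | _ = ≤-trans (weighted≤topSum (nonIncreasing-tail d↓) (w ∘ Fin.suc) (w≤1 ∘ Fin.suc) Σw≤k)
                         (topSum-tail≤ k d↓)
... | suc (suc _) | s≤s ()
... | suc zero | _ with k | Σw≤k
...   | suc k′ | 1+Σw≤k = begin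
  1 * d Fin.zero + sumFin (λ i → w (Fin.suc i) * d (Fin.suc i))
    ≤⟨ +-mono-≤ (≤-reflexive (*-identityˡ _))
                (weighted≤topSum (nonIncreasing-tail d↓) (w ∘ Fin.suc) (w≤1 ∘ Fin.suc) (s≤s⁻¹ 1+Σw≤k)) ⟩
  d Fin.zero + topSum (d ∘ Fin.suc) k′ ≡⟨ topSum-suc d k′ ⟨
  topSum d (suc k′) ∎
  where open ≤-Reasoning

≤entry : ∀ {n} {d : Fin n → ℕ} {k} → NonIncreasing d → (v : Fin n) → k ≤ toℕ v → d v ≤ entry d k
≤entry {suc n} {k = zero}  d↓ v           _         = d↓ Fin.zero v z≤n
≤entry {suc n} {k = suc k} d↓ (Fin.suc v) (s≤s k≤v) = ≤entry (nonIncreasing-tail d↓) v k≤v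

≤d₁ : ∀ {n} {d : Fin n → ℕ} → NonIncreasing d → ∀ v → d v ≤ d₁ d
≤d₁ d↓ v = ≤entry d↓ v z≤n

light⇒≤dₕ : ∀ {n} {d : Fin n → ℕ} {h} → NonIncreasing d → ∀ {v} → Light h v → d v ≤ dₕ d h
light⇒≤dₕ {h = h} d↓ {v} light = ≤entry d↓ v (≤-trans (m∸n≤m h 1) light)

ff2+n≡n*n : ∀ x → ff2 x + x ≡ x * x
ff2+n≡n*n zero    = refl
ff2+n≡n*n (suc x) = expand x
  where
  expand : ∀ x → suc x * x + suc x ≡ suc x * suc x
  expand = solve-∀

ff2≤n*n : ∀ x → ff2 x ≤ x * x
ff2≤n*n x = *-monoʳ-≤ x (m∸n≤m x 1)

ff2-mono : ∀ {x y} → x ≤ y → ff2 x ≤ ff2 y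
ff2-mono x≤y = *-mono-≤ x≤y (∸-monoˡ-≤ 1 x≤y)

ff2-+≤ : ∀ s b → ff2 (s + b) ≤ ff2 s + 2 * b * (s + b)
ff2-+≤ s b = +-cancelʳ-≤ s _ _ (begin
  ff2 (s + b) + s             ≤⟨ +-monoʳ-≤ (ff2 (s + b)) (m≤m+n s b) ⟩
  ff2 (s + b) + (s + b)       ≡⟨ ff2+n≡n*n (s + b) ⟩
  (s + b) * (s + b)           ≤⟨ m≤m+n _ (b * b) ⟩
  (s + b) * (s + b) + b * b   ≡⟨ square s b ⟩
  s * s + 2 * b * (s + b)     ≡⟨ cong (_+ 2 * b * (s + b)) (ff2+n≡n*n s) ⟨
  ff2 s + s + 2 * b * (s + b) ≡⟨ swap (ff2 s) s _ ⟩
  ff2 s + 2 * b * (s + b) + s ∎)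
  where
  open ≤-Reasoning
  square : ∀ s b → (s + b) * (s + b) + b * b ≡ s * s + 2 * b * (s + b)
  square = solve-∀
  swap : ∀ a b c → a + b + c ≡ a + c + b
  swap = solve-∀

ff2-≤-excess : ∀ {x} s u → x ≤ s + u → ff2 x ≤ ff2 s + 2 * u * x
ff2-≤-excess {x} s u x≤s+u with x ≤? s
... | yes x≤s = ≤-trans (ff2-mono x≤s) (m≤m+n _ _)
... | no  x≰s with m≤n⇒∃[o]m+o≡n (≰⇒≥ x≰s)
...   | b , refl = ≤-trans (ff2-+≤ s b)
                     (+-monoʳ-≤ (ff2 s) (*-monoˡ-≤ (s + b) (*-monoʳ-≤ 2 (+-cancelˡ-≤ s b u x≤s+u))))

-- For a vertex carrying a loop (l = 1) the crude bound [x]₂ ≤ D² suffices.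
ff2-≤-excess-loop : ∀ {x D l} s u → x ≤ D → l ≤ 1 → x ≤ s + (u + 2 * l) →
                    ff2 x ≤ ff2 s + ((2 * D) * u + (D * D) * l)
ff2-≤-excess-loop {x} {D} {zero} s u x≤D _ x≤ = begin
  ff2 x                             ≤⟨ ff2-≤-excess s u (≤-trans x≤ (≤-reflexive (cong (_+_ s) (+-identityʳ u)))) ⟩
  ff2 s + 2 * u * x                 ≤⟨ +-monoʳ-≤ (ff2 s) (*-monoʳ-≤ (2 * u) x≤D) ⟩
  ff2 s + 2 * u * D                 ≡⟨ cong (_+_ (ff2 s)) (rearrange u D) ⟩
  ff2 s + ((2 * D) * u + (D * D) * 0) ∎
  where
  open ≤-Reasoning
  rearrange : ∀ u D → 2 * u * D ≡ (2 * D) * u + (D * D) * 0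
  rearrange = solve-∀
ff2-≤-excess-loop {x} {D} {suc zero} s u x≤D _ _ = begin
  ff2 x                              ≤⟨ ff2≤n*n x ⟩
  x * x                              ≤⟨ *-mono-≤ x≤D x≤D ⟩
  D * D                              ≡⟨ *-identityʳ (D * D) ⟨
  (D * D) * 1                        ≤⟨ m≤n+m _ _ ⟩
  (2 * D) * u + (D * D) * 1          ≤⟨ m≤n+m _ (ff2 s) ⟩
  ff2 s + ((2 * D) * u + (D * D) * 1) ∎
  where open ≤-Reasoning
ff2-≤-excess-loop {l = suc (suc _)} _ _ _ (s≤s ()) _

i≤m+n⇒i-n≤m : ∀ {i} m n → i ≤ℤ + (m + n) → i - + n ≤ℤ + m
i≤m+n⇒i-n≤m {i} m n i≤m+n = ℤ.≤-trans (ℤ.+-monoˡ-≤ (ℤ.- + n) i≤m+n) (ℤ.≤-reflexive (begin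
  + (m + n) - + n     ≡⟨ ℤ.[+m]-[+n]≡m⊖n (m + n) n ⟩
  (m + n) ⊖ n         ≡⟨ cong₂ _⊖_ (+-comm m n) (sym (+-identityʳ n)) ⟩
  (n + m) ⊖ (n + 0)   ≡⟨ ℤ.+-cancelˡ-⊖ n m 0 ⟩
  m ⊖ 0               ≡⟨ ℤ.[+m]-[+n]≡m⊖n m 0 ⟨
  + m - + 0           ≡⟨ ℤ.+-identityʳ (+ m) ⟩
  + m                 ∎))
  where open ≡-Reasoning

simpleDegree : ∀ {n} → Multigraph n → Fin n → ℕ
simpleDegree G i = sumFin (λ j → ind (simpleEdge? G i j))

simplePairs : ∀ {n} → Multigraph n → ℕ
simplePairs G = sumFin (simpleDegree G)

ind-simpleEdge≤mult : ∀ {n} (G : Multigraph n) i j → ind (simpleEdge? G i j) ≤ mult G i j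
ind-simpleEdge≤mult G i j with simpleEdge? G i j
... | yes (_ , m≡1) = ≤-reflexive (sym m≡1)
... | no  _         = z≤n

ind-simpleEdge-sym : ∀ {n} (G : Multigraph n) i j → ind (simpleEdge? G i j) ≡ ind (simpleEdge? G j i)
ind-simpleEdge-sym G i j = ind-cong (simpleEdge? G i j) (simpleEdge? G j i) flip flip
  where
  flip : ∀ {u w} → SimpleEdge G u w → SimpleEdge G w u
  flip {u} {w} (u≢w , m≡1) = u≢w ∘ sym , trans (symm G w u) m≡1

simpleDegree≤deg : ∀ {n} (G : Multigraph n) i → simpleDegree G i ≤ deg G i
simpleDegree≤deg G i = ≤-trans (sumFin-mono (ind-simpleEdge≤mult G i)) (m≤m+n _ _)

orientedLightMulti? : ∀ {n} h (G : Multigraph n) k (i j : Fin n) →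
                      Dec (toℕ i < toℕ j × mult G i j ≡ k × (Light h i ⊎ Light h j))
orientedLightMulti? h G k i j =
  (toℕ i <? toℕ j) ×-dec ((mult G i j ℕ.≟ k) ×-dec (light? h i ⊎-dec light? h j))

lightMultiEdge : ∀ {n} → ℕ → Multigraph n → ℕ → Fin n → Fin n → ℕ
lightMultiEdge h G k i j = ind (orientedLightMulti? h G k i j) + ind (orientedLightMulti? h G k j i)

sum-lightMultiEdge : ∀ {n} h (G : Multigraph n) k →
                     sumFin (λ i → sumFin (lightMultiEdge h G k i))
                     ≡ countLightMulti h G k + countLightMulti h G k
sum-lightMultiEdge h G k =
  trans (sumFin₂-distrib-+ (λ i j → ind (oriented i j)) (λ i j → ind (oriented j i)))
        (cong (_+_ (countLightMulti h G k)) (sym (sumFin-comm (λ i j → ind (oriented i j)))))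
  where
  oriented : ∀ i j → Dec (toℕ i < toℕ j × mult G i j ≡ k × (Light h i ⊎ Light h j))
  oriented = orientedLightMulti? h G k

lightMultiEdge-pos : ∀ {n} {h} (G : Multigraph n) {k i j} → i ≢ j → mult G i j ≡ k →
                     Light h i ⊎ Light h j → 1 ≤ lightMultiEdge h G k i j
lightMultiEdge-pos {h = h} G {k} {i} {j} i≢j m≡k light with <-cmp (toℕ i) (toℕ j)
... | tri< i<j _ _ = ≤-trans (≤-reflexive (sym (ind-true (orientedLightMulti? h G k i j) (i<j , m≡k , light))))
                             (m≤m+n _ _)
... | tri≈ _ i≡j _ = ⊥-elim (i≢j (Finₚ.toℕ-injective i≡j))
... | tri> _ _ j<i = ≤-trans (≤-reflexive (sym (ind-true (orientedLightMulti? h G k j i)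
                               (j<i , trans (symm G j i) m≡k , Sum.swap light))))
                             (m≤n+m _ _)

multiDegree : ∀ {n} → ℕ → Multigraph n → Fin n → ℕ
multiDegree h G i = sumFin (λ j → 3 * lightMultiEdge h G 3 i j + 2 * lightMultiEdge h G 2 i j)

sum-multiDegree : ∀ {n} h (G : Multigraph n) →
                  sumFin (multiDegree h G)
                  ≡ 3 * (countLightMulti h G 3 + countLightMulti h G 3)
                    + 2 * (countLightMulti h G 2 + countLightMulti h G 2)
sum-multiDegree h G = begin
  sumFin (multiDegree h G)
    ≡⟨ sumFin-cong (λ i → sumFin-linear 3 2 (lightMultiEdge h G 3 i) (lightMultiEdge h G 2 i)) ⟩
  sumFin (λ i → 3 * sumFin (lightMultiEdge h G 3 i) + 2 * sumFin (lightMultiEdge h G 2 i))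
    ≡⟨ sumFin-linear 3 2 (λ i → sumFin (lightMultiEdge h G 3 i)) (λ i → sumFin (lightMultiEdge h G 2 i)) ⟩
  3 * sumFin (λ i → sumFin (lightMultiEdge h G 3 i)) + 2 * sumFin (λ i → sumFin (lightMultiEdge h G 2 i))
    ≡⟨ cong₂ (λ x y → 3 * x + 2 * y) (sum-lightMultiEdge h G 3) (sum-lightMultiEdge h G 2) ⟩
  3 * (countLightMulti h G 3 + countLightMulti h G 3) + 2 * (countLightMulti h G 2 + countLightMulti h G 2) ∎
  where open ≡-Reasoning

lightLoop : ∀ {n} → ℕ → Multigraph n → Fin n → ℕ
lightLoop h G i = ind (light? h i ×-dec (mult G i i ℕ.≟ 1))

loop≤lightLoop : ∀ {n} {h} (G : Multigraph n) → NoOtherNonSimple h G → ∀ i → mult G i i ≤ lightLoop h G i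
loop≤lightLoop {h = h} G (_ , loops) i with 1 ≤? mult G i i
... | yes 1≤m = let (light , m≡1) = loops i 1≤m in
  ≤-trans (≤-reflexive m≡1) (≤-reflexive (sym (ind-true (light? h i ×-dec (mult G i i ℕ.≟ 1)) (light , m≡1))))
... | no  1≰m = ≤-trans (≤-reflexive (n<1⇒n≡0 (≰⇒> 1≰m))) z≤n

multiEdge≤ : ∀ {n} h (G : Multigraph n) {i j} c → i ≢ j → mult G i j ≡ c →
             Light h i ⊎ Light h j → mult G i j ≤ c * lightMultiEdge h G c i j
multiEdge≤ h G c i≢j m≡c light = ≤-trans (≤-reflexive (trans m≡c (sym (*-identityʳ c))))
                                         (*-monoʳ-≤ c (lightMultiEdge-pos G i≢j m≡c light))

mult≤-offDiagonal : ∀ {n} {h} (G : Multigraph n) → NoOtherNonSimple h G → ∀ i j → i ≢ j →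
                    mult G i j ≤ ind (simpleEdge? G i j) + (3 * lightMultiEdge h G 3 i j + 2 * lightMultiEdge h G 2 i j)
mult≤-offDiagonal {h = h} G (multis , _) i j i≢j with 2 ≤? mult G i j
... | no 2≰m = ≤-trans (single (n≤1⇒n≡0∨n≡1 (s≤s⁻¹ (≰⇒> 2≰m)))) (m≤m+n _ _)
  where
  single : mult G i j ≡ 0 ⊎ mult G i j ≡ 1 → mult G i j ≤ ind (simpleEdge? G i j)
  single (inj₁ m≡0) = ≤-trans (≤-reflexive m≡0) z≤n
  single (inj₂ m≡1) = ≤-trans (≤-reflexive m≡1) (≤-reflexive (sym (ind-true (simpleEdge? G i j) (i≢j , m≡1))))
... | yes 2≤m with multis i j i≢j 2≤m
...   | light , inj₁ m≡2 = ≤-trans (multiEdge≤ h G 2 i≢j m≡2 light)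
                                  (≤-trans (m≤n+m _ (3 * lightMultiEdge h G 3 i j)) (m≤n+m _ (ind (simpleEdge? G i j))))
...   | light , inj₂ m≡3 = ≤-trans (multiEdge≤ h G 3 i≢j m≡3 light)
                                  (≤-trans (m≤m+n _ (2 * lightMultiEdge h G 2 i j)) (m≤n+m _ (ind (simpleEdge? G i j))))

mult≤contribution : ∀ {n} {h} (G : Multigraph n) → NoOtherNonSimple h G → ∀ i j →
                    mult G i j ≤ ind (simpleEdge? G i j)
                                 + (3 * lightMultiEdge h G 3 i j + 2 * lightMultiEdge h G 2 i j)
                                 + ind (j Fin.≟ i) * lightLoop h G i
mult≤contribution {h = h} G noOther i j with j Fin.≟ i
... | yes refl = ≤-trans (loop≤lightLoop G noOther i)
                         (≤-trans (≤-reflexive (sym (+-identityʳ (lightLoop h G i)))) (m≤n+m _ offDiagonal))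
  where
  offDiagonal : ℕ
  offDiagonal = ind (simpleEdge? G i i) + (3 * lightMultiEdge h G 3 i i + 2 * lightMultiEdge h G 2 i i)
... | no  j≢i  = ≤-trans (mult≤-offDiagonal G noOther i j (j≢i ∘ sym)) (m≤m+n _ 0)

deg≤ : ∀ {n} {h} (G : Multigraph n) → NoOtherNonSimple h G → ∀ i →
       deg G i ≤ simpleDegree G i + (multiDegree h G i + 2 * lightLoop h G i)
deg≤ {h = h} G noOther i = begin
  sumFin (mult G i) + mult G i i
    ≤⟨ +-mono-≤ (sumFin-mono (mult≤contribution G noOther i)) (loop≤lightLoop G noOther i) ⟩
  sumFin (λ j → se j + w j + ind (j Fin.≟ i) * ℓ) + ℓ
    ≡⟨ cong (_+ ℓ) (trans (sumFin-distrib-+ (λ j → se j + w j) (λ j → ind (j Fin.≟ i) * ℓ))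
                          (cong₂ _+_ (sumFin-distrib-+ se w) (sumFin-ind-≟ i (λ _ → ℓ)))) ⟩
  simpleDegree G i + multiDegree h G i + ℓ + ℓ
    ≡⟨ regroup (simpleDegree G i) (multiDegree h G i) ℓ ⟩
  simpleDegree G i + (multiDegree h G i + 2 * ℓ) ∎
  where
  open ≤-Reasoning
  se w : Fin _ → ℕ
  se j = ind (simpleEdge? G i j)
  w j = 3 * lightMultiEdge h G 3 i j + 2 * lightMultiEdge h G 2 i j
  ℓ : ℕ
  ℓ = lightLoop h G i
  regroup : ∀ s u l → s + u + l + l ≡ s + (u + 2 * l)
  regroup = solve-∀

twoStarsAt : ∀ {n} → ℕ → Multigraph n → Fin n → ℕ
twoStarsAt h G v = sumFin (λ v2 → sumFin (λ v3 → ind (lightSimpleTwoStar? h G v v2 v3)))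

-- An ordered pair of simple neighbours of a light vertex is a two-star unless it repeats a neighbour.
twoStar-or-repeat : ∀ {n} {h} (G : Multigraph n) {v} → Light h v → ∀ v2 v3 →
                    ind (lightSimpleTwoStar? h G v v2 v3) + ind (v3 Fin.≟ v2) * ind (simpleEdge? G v v2)
                    ≡ ind (simpleEdge? G v v2) * ind (simpleEdge? G v v3)
twoStar-or-repeat {h = h} G {v} light v2 v3 = cases (simpleEdge? G v v2) (simpleEdge? G v v3) (v3 Fin.≟ v2)
  where
  star? : Dec (LightSimpleTwoStar h G v v2 v3)
  star? = lightSimpleTwoStar? h G v v2 v3
  cases : (x2 : Dec (SimpleEdge G v v2)) (x3 : Dec (SimpleEdge G v v3)) (e : Dec (v3 ≡ v2)) →
          ind star? + ind e * ind x2 ≡ ind x2 * ind x3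
  cases (yes e2) (yes e3) (no v3≢v2) =
    trans (+-identityʳ _) (ind-true star? (light , proj₁ e2 , proj₁ e3 , v3≢v2 ∘ sym , e2 , e3))
  cases (yes _)  (yes _)  (yes refl) = cong (_+ 1) (ind-false star? (λ (_ , _ , _ , v2≢v2 , _) → v2≢v2 refl))
  cases (yes e2) (no ¬e3) (yes refl) = ⊥-elim (¬e3 e2)
  cases (yes _)  (no ¬e3) (no _)     = trans (+-identityʳ _) (ind-false star? (λ (_ , _ , _ , _ , _ , e3) → ¬e3 e3))
  cases (no ¬e2) _        e          =
    cong₂ _+_ (ind-false star? (λ (_ , _ , _ , _ , e2 , _) → ¬e2 e2)) (*-zeroʳ (ind e))

twoStarsAt-light : ∀ {n} {h} (G : Multigraph n) {v} → Light h v → twoStarsAt h G v ≡ ff2 (simpleDegree G v)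
twoStarsAt-light {h = h} G {v} light = +-cancelʳ-≡ s _ _ (begin
  twoStarsAt h G v + s
    ≡⟨ cong (_+_ (twoStarsAt h G v)) (sumFin-cong (λ v2 → sumFin-ind-≟ v2 (λ _ → se v2))) ⟨
  twoStarsAt h G v + sumFin (λ v2 → sumFin (λ v3 → ind (v3 Fin.≟ v2) * se v2))
    ≡⟨ sumFin₂-distrib-+ (λ v2 v3 → ind (lightSimpleTwoStar? h G v v2 v3)) (λ v2 v3 → ind (v3 Fin.≟ v2) * se v2) ⟨
  sumFin (λ v2 → sumFin (λ v3 → ind (lightSimpleTwoStar? h G v v2 v3) + ind (v3 Fin.≟ v2) * se v2))
    ≡⟨ sumFin-cong (λ v2 → sumFin-cong (twoStar-or-repeat G light v2)) ⟩
  sumFin (λ v2 → sumFin (λ v3 → se v2 * se v3))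
    ≡⟨ sumFin-cong (λ v2 → trans (*-comm s (se v2)) (*-distribˡ-sumFin (se v2) se)) ⟨
  sumFin (λ v2 → s * se v2)
    ≡⟨ *-distribˡ-sumFin s se ⟨
  s * s
    ≡⟨ ff2+n≡n*n s ⟨
  ff2 s + s ∎)
  where
  open ≡-Reasoning
  se : Fin _ → ℕ
  se w = ind (simpleEdge? G v w)
  s : ℕ
  s = simpleDegree G v

-- Counting the pairs of b_l(G, v1v2v3)

BlStarPair : ∀ {n} → Multigraph n → (v1 v2 v3 v4 v5 : Fin n) → Set
BlStarPair G v1 v2 v3 v4 v5 =
  SimpleEdge G v4 v5 × v4 ≢ v1 × v4 ≢ v2 × v4 ≢ v3 × v5 ≢ v1 × v5 ≢ v2 × v5 ≢ v3
  × mult G v2 v4 ≡ 0 × mult G v3 v5 ≡ 0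

blStarPair? : ∀ {n} (G : Multigraph n) v1 v2 v3 v4 v5 → Dec (BlStarPair G v1 v2 v3 v4 v5)
blStarPair? G v1 v2 v3 v4 v5 =
  simpleEdge? G v4 v5
  ×-dec ¬? (v4 Fin.≟ v1) ×-dec ¬? (v4 Fin.≟ v2) ×-dec ¬? (v4 Fin.≟ v3)
  ×-dec ¬? (v5 Fin.≟ v1) ×-dec ¬? (v5 Fin.≟ v2) ×-dec ¬? (v5 Fin.≟ v3)
  ×-dec (mult G v2 v4 ℕ.≟ 0) ×-dec (mult G v3 v5 ℕ.≟ 0)

obstructions : ∀ {n} → Multigraph n → (v1 v2 v3 v4 v5 : Fin n) → ℕ
obstructions G v1 v2 v3 v4 v5 =
  ind (v4 Fin.≟ v1) + (ind (v4 Fin.≟ v2) + (ind (v4 Fin.≟ v3) +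
  (ind (v5 Fin.≟ v1) + (ind (v5 Fin.≟ v2) + (ind (v5 Fin.≟ v3) +
  (ind (¬? (mult G v2 v4 ℕ.≟ 0)) + ind (¬? (mult G v3 v5 ℕ.≟ 0))))))))

simpleEdge≤blStarPair+obstructions : ∀ {n} (G : Multigraph n) v1 v2 v3 v4 v5 →
  ind (simpleEdge? G v4 v5)
  ≤ ind (blStarPair? G v1 v2 v3 v4 v5) + obstructions G v1 v2 v3 v4 v5 * ind (simpleEdge? G v4 v5)
simpleEdge≤blStarPair+obstructions G v1 v2 v3 v4 v5 =
  ind≤ind-×-dec (simpleEdge? G v4 v5) _
    (1≤ind-¬?-×-dec (v4 Fin.≟ v1) _ (1≤ind-¬?-×-dec (v4 Fin.≟ v2) _ (1≤ind-¬?-×-dec (v4 Fin.≟ v3) _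
    (1≤ind-¬?-×-dec (v5 Fin.≟ v1) _ (1≤ind-¬?-×-dec (v5 Fin.≟ v2) _ (1≤ind-¬?-×-dec (v5 Fin.≟ v3) _
    (1≤ind-×-dec (mult G v2 v4 ℕ.≟ 0) _ (ind-excluded-middle (mult G v3 v5 ℕ.≟ 0)))))))))

-- Kept abstract so that the weights in the bounds below are inferred by unification.
abstract

  weightedSimplePairs : ∀ {n} → Multigraph n → (Fin n → Fin n → ℕ) → ℕ
  weightedSimplePairs G w = sumFin (λ i → sumFin (λ j → w i j * ind (simpleEdge? G i j)))

  weightedSimplePairs-flip : ∀ {n} (G : Multigraph n) (w : Fin n → Fin n → ℕ) →
                             weightedSimplePairs G (λ i j → w j i) ≡ weightedSimplePairs G w
  weightedSimplePairs-flip G w = trans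
    (sumFin-cong (λ i → sumFin-cong (λ j → cong (w j i *_) (ind-simpleEdge-sym G i j))))
    (sym (sumFin-comm (λ j i → w j i * ind (simpleEdge? G j i))))

  weightedSimplePairs-row : ∀ {n} (G : Multigraph n) (f : Fin n → ℕ) →
                            weightedSimplePairs G (λ i _ → f i) ≡ sumFin (λ i → f i * simpleDegree G i)
  weightedSimplePairs-row G f = sumFin-cong (λ i → sym (*-distribˡ-sumFin (f i) (λ j → ind (simpleEdge? G i j))))

  weightedSimplePairs-+ : ∀ {n} (G : Multigraph n) {w w′ : Fin n → Fin n → ℕ} {a b} →
                          weightedSimplePairs G w ≤ a → weightedSimplePairs G w′ ≤ b →
                          weightedSimplePairs G (λ i j → w i j + w′ i j) ≤ a + b
  weightedSimplePairs-+ G {w} {w′} ≤a ≤b = ≤-trans (≤-reflexive (trans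
    (sumFin-cong (λ i → sumFin-cong (λ j → *-distribʳ-+ (ind (simpleEdge? G i j)) (w i j) (w′ i j))))
    (sumFin₂-distrib-+ (λ i j → w i j * ind (simpleEdge? G i j)) (λ i j → w′ i j * ind (simpleEdge? G i j)))))
    (+-mono-≤ ≤a ≤b)

  simplePairs≤ : ∀ {n} (G : Multigraph n) v1 v2 v3 →
                 simplePairs G ≤ blStar G v1 v2 v3 + weightedSimplePairs G (obstructions G v1 v2 v3)
  simplePairs≤ G v1 v2 v3 = ≤-trans
    (sumFin-mono (λ v4 → sumFin-mono (simpleEdge≤blStarPair+obstructions G v1 v2 v3 v4)))
    (≤-reflexive (sumFin₂-distrib-+ (λ v4 v5 → ind (blStarPair? G v1 v2 v3 v4 v5))
                                    (λ v4 v5 → obstructions G v1 v2 v3 v4 v5 * ind (simpleEdge? G v4 v5))))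

weightedSimplePairs-at : ∀ {n} {d : Fin n → ℕ} (G : Multigraph n) → HasDegrees G d → ∀ a →
                         weightedSimplePairs G (λ i _ → ind (i Fin.≟ a)) ≤ d a
weightedSimplePairs-at {d = d} G degs a = begin
  weightedSimplePairs G (λ i _ → ind (i Fin.≟ a)) ≡⟨ weightedSimplePairs-row G (λ i → ind (i Fin.≟ a)) ⟩
  sumFin (λ i → ind (i Fin.≟ a) * simpleDegree G i) ≡⟨ sumFin-ind-≟ a (simpleDegree G) ⟩
  simpleDegree G a                                  ≤⟨ simpleDegree≤deg G a ⟩
  deg G a                                           ≡⟨ degs a ⟩
  d a                                               ∎
  where open ≤-Reasoning

ind-nonzero≤ : ∀ m → ind (¬? (m ℕ.≟ 0)) ≤ m
ind-nonzero≤ zero    = z≤n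
ind-nonzero≤ (suc m) = ≤-trans (ind≤1 (¬? (suc m ℕ.≟ 0))) (s≤s z≤n)

-- A vertex has at most d₁ neighbours, so the degrees of its neighbours add up to at most A₂.
weightedSimplePairs-neighbours : ∀ {n} {d : Fin n → ℕ} (G : Multigraph n) → HasDegrees G d → NonIncreasing d →
                                 ∀ a → weightedSimplePairs G (λ i _ → ind (¬? (mult G a i ℕ.≟ 0))) ≤ A2 d
weightedSimplePairs-neighbours {d = d} G degs d↓ a = begin
  weightedSimplePairs G (λ i _ → adjacent i) ≡⟨ weightedSimplePairs-row G adjacent ⟩
  sumFin (λ i → adjacent i * simpleDegree G i)
    ≤⟨ sumFin-mono (λ i → *-monoʳ-≤ (adjacent i) (≤-trans (simpleDegree≤deg G i) (≤-reflexive (degs i)))) ⟩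
  sumFin (λ i → adjacent i * d i)
    ≤⟨ weighted≤topSum d↓ adjacent (λ i → ind≤1 (¬? (mult G a i ℕ.≟ 0))) (begin
         sumFin adjacent           ≤⟨ sumFin-mono (λ i → ind-nonzero≤ (mult G a i)) ⟩
         sumFin (mult G a)         ≤⟨ m≤m+n _ _ ⟩
         deg G a                   ≡⟨ degs a ⟩
         d a                       ≤⟨ ≤d₁ d↓ a ⟩
         d₁ d                      ∎) ⟩
  A2 d ∎
  where
  open ≤-Reasoning
  adjacent : Fin _ → ℕ
  adjacent i = ind (¬? (mult G a i ℕ.≟ 0))

obstructions≤ : ∀ {n} {d : Fin n → ℕ} {h} (G : Multigraph n) → HasDegrees G d → NonIncreasing d →
                ∀ {v1} v2 v3 → Light h v1 →
                weightedSimplePairs G (obstructions G v1 v2 v3)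
                ≤ dₕ d h + (d₁ d + (d₁ d + (dₕ d h + (d₁ d + (d₁ d + (A2 d + A2 d))))))
obstructions≤ {n} {d} {h} G degs d↓ {v1} v2 v3 light =
  endpoint v1 light≤ ⊕ endpoint v2 (≤d₁ d↓ v2) ⊕ endpoint v3 (≤d₁ d↓ v3) ⊕
  endpoint′ v1 light≤ ⊕ endpoint′ v2 (≤d₁ d↓ v2) ⊕ endpoint′ v3 (≤d₁ d↓ v3) ⊕
  weightedSimplePairs-neighbours G degs d↓ v2 ⊕
  subst (_≤ A2 d) (sym (weightedSimplePairs-flip G (λ i _ → ind (¬? (mult G v3 i ℕ.≟ 0)))))
        (weightedSimplePairs-neighbours G degs d↓ v3)
  where
  infixr 5 _⊕_
  _⊕_ : ∀ {w w′ : Fin n → Fin n → ℕ} {a b} → weightedSimplePairs G w ≤ a → weightedSimplePairs G w′ ≤ b →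
        weightedSimplePairs G (λ i j → w i j + w′ i j) ≤ a + b
  _⊕_ = weightedSimplePairs-+ G
  endpoint : ∀ a {D} → d a ≤ D → weightedSimplePairs G (λ i _ → ind (i Fin.≟ a)) ≤ D
  endpoint a = ≤-trans (weightedSimplePairs-at G degs a)
  endpoint′ : ∀ a {D} → d a ≤ D → weightedSimplePairs G (λ _ j → ind (j Fin.≟ a)) ≤ D
  endpoint′ a = subst (_≤ _) (sym (weightedSimplePairs-flip G (λ i _ → ind (i Fin.≟ a)))) ∘ endpoint a
  light≤ : d v1 ≤ dₕ d h
  light≤ = light⇒≤dₕ d↓ light

L2≤ : ∀ {n} {d : Fin n → ℕ} {h} (G : Multigraph n) → NoOtherNonSimple h G → HasDegrees G d → NonIncreasing d →
      L2 d h ≤ bl∅ h G + ((2 * dₕ d h) * sumFin (multiDegree h G) + (dₕ d h * dₕ d h) * countLightSingleLoops h G)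
L2≤ {d = d} {h} G noOther degs d↓ = begin
  L2 d h
    ≤⟨ sumFin-mono vertexBound ⟩
  sumFin (λ v → twoStarsAt h G v + excess v)
    ≡⟨ sumFin-distrib-+ (twoStarsAt h G) excess ⟩
  bl∅ h G + sumFin excess
    ≡⟨ cong (_+_ (bl∅ h G)) (sumFin-linear (2 * D) (D * D) (multiDegree h G) (lightLoop h G)) ⟩
  bl∅ h G + ((2 * D) * sumFin (multiDegree h G) + (D * D) * countLightSingleLoops h G) ∎
  where
  open ≤-Reasoning
  D : ℕ
  D = dₕ d h
  excess : Fin _ → ℕ
  excess v = (2 * D) * multiDegree h G v + (D * D) * lightLoop h G v
  vertexBound : ∀ v → ind (light? h v) * ff2 (d v) ≤ twoStarsAt h G v + excess v
  vertexBound v = ind*-≤ (light? h v) λ light →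
    subst (λ t → ff2 (d v) ≤ t + excess v) (sym (twoStarsAt-light G light))
      (ff2-≤-excess-loop (simpleDegree G v) (multiDegree h G v) (light⇒≤dₕ d↓ light)
             (ind≤1 (light? h v ×-dec (mult G v v ℕ.≟ 1))) (subst (_≤ _) (degs v) (deg≤ G noOther v)))

M1≤ : ∀ {n} {d : Fin n → ℕ} {h} (G : Multigraph n) → NoOtherNonSimple h G → HasDegrees G d →
      M1 d ≤ simplePairs G + (sumFin (multiDegree h G) + 2 * countLightSingleLoops h G)
M1≤ {d = d} {h} G noOther degs = begin
  sumFin d
    ≡⟨ sumFin-cong degs ⟨
  sumFin (deg G)
    ≤⟨ sumFin-mono (deg≤ G noOther) ⟩
  sumFin (λ i → simpleDegree G i + (multiDegree h G i + 2 * lightLoop h G i))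
    ≡⟨ sumFin-distrib-+ (simpleDegree G) (λ i → multiDegree h G i + 2 * lightLoop h G i) ⟩
  simplePairs G + sumFin (λ i → multiDegree h G i + 2 * lightLoop h G i)
    ≡⟨ cong (_+_ (simplePairs G)) (sumFin-distrib-+ (multiDegree h G) (λ i → 2 * lightLoop h G i)) ⟩
  simplePairs G + (sumFin (multiDegree h G) + sumFin (λ i → 2 * lightLoop h G i))
    ≡⟨ cong (λ l → simplePairs G + (sumFin (multiDegree h G) + l)) (*-distribˡ-sumFin 2 (lightLoop h G)) ⟨
  simplePairs G + (sumFin (multiDegree h G) + 2 * countLightSingleLoops h G) ∎
  where open ≤-Reasoning

bl∅-lowerBound : ∀ {n} {d : Fin n → ℕ} {h mt md ml} → NonIncreasing d → (G : Multigraph n) →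
                 InS d h mt md ml G → lowerBound0 d h mt md ml ≤ℤ + bl∅ h G
bl∅-lowerBound {d = d} {h} d↓ G (degs , refl , refl , refl , noOther) =
  i≤m+n⇒i-n≤m _ _ (i≤m+n⇒i-n≤m _ _ (i≤m+n⇒i-n≤m _ _ (ℤ.+≤+ (begin
    L2 d h
      ≤⟨ L2≤ G noOther degs d↓ ⟩
    bl∅ h G + ((2 * D) * sumFin (multiDegree h G) + (D * D) * ℓ)
      ≡⟨ cong (λ u → bl∅ h G + ((2 * D) * u + (D * D) * ℓ)) (sum-multiDegree h G) ⟩
    bl∅ h G + ((2 * D) * (3 * (t + t) + 2 * (δ + δ)) + (D * D) * ℓ)
      ≡⟨ regroup (bl∅ h G) D t δ ℓ ⟩
    bl∅ h G + ℓ * (D * D) + 8 * δ * D + 12 * t * D ∎))))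
  where
  open ≤-Reasoning
  D t δ ℓ : ℕ
  D = dₕ d h
  t = countLightMulti h G 3
  δ = countLightMulti h G 2
  ℓ = countLightSingleLoops h G
  regroup : ∀ b D t δ ℓ → b + ((2 * D) * (3 * (t + t) + 2 * (δ + δ)) + (D * D) * ℓ)
                          ≡ b + ℓ * (D * D) + 8 * δ * D + 12 * t * D
  regroup = solve-∀

blStar-lowerBound : ∀ {n} {d : Fin n → ℕ} {h mt md ml} → NonIncreasing d → (G : Multigraph n) →
                    InS d h mt md ml G → ∀ {v1} v2 v3 → Light h v1 →
                    lowerBound1 d h mt md ml ≤ℤ + blStar G v1 v2 v3
blStar-lowerBound {d = d} {h} d↓ G (degs , refl , refl , refl , noOther) {v1} v2 v3 light =
  i≤m+n⇒i-n≤m _ _ (i≤m+n⇒i-n≤m _ _ (i≤m+n⇒i-n≤m _ _ (i≤m+n⇒i-n≤m _ _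
  (i≤m+n⇒i-n≤m _ _ (i≤m+n⇒i-n≤m _ _ (ℤ.+≤+ (begin
    M1 d
      ≤⟨ M1≤ G noOther degs ⟩
    simplePairs G + (sumFin (multiDegree h G) + 2 * ℓ)
      ≤⟨ +-mono-≤ (≤-trans (simplePairs≤ G v1 v2 v3) (+-monoʳ-≤ b (obstructions≤ G degs d↓ v2 v3 light)))
                  (≤-reflexive (cong (_+ 2 * ℓ) (sum-multiDegree h G))) ⟩
    b + (Dₕ + (D₁ + (D₁ + (Dₕ + (D₁ + (D₁ + (A + A))))))) + (3 * (t + t) + 2 * (δ + δ) + 2 * ℓ)
      ≡⟨ regroup b Dₕ D₁ A t δ ℓ ⟩
    b + 2 * Dₕ + 4 * D₁ + 2 * A + 2 * ℓ + 4 * δ + 6 * t ∎)))))))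
  where
  open ≤-Reasoning
  b Dₕ D₁ A t δ ℓ : ℕ
  b = blStar G v1 v2 v3
  Dₕ = dₕ d h
  D₁ = d₁ d
  A = A2 d
  t = countLightMulti h G 3
  δ = countLightMulti h G 2
  ℓ = countLightSingleLoops h G
  regroup : ∀ b Dₕ D₁ A t δ ℓ →
            b + (Dₕ + (D₁ + (D₁ + (Dₕ + (D₁ + (D₁ + (A + A))))))) + (3 * (t + t) + 2 * (δ + δ) + 2 * ℓ)
            ≡ b + 2 * Dₕ + 4 * D₁ + 2 * A + 2 * ℓ + 4 * δ + 6 * t
  regroup = solve-∀

lemma4 : (n : ℕ) (d : Fin n → ℕ) → NonIncreasing d →
         (h : ℕ) → 1 ≤ h → h < n → (mt md ml : ℕ) →
         ((G : Multigraph n) → InS d h mt md ml G →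
            lowerBound0 d h mt md ml ≤ℤ + bl∅ h G)
         × ((G : Multigraph n) → InS d h mt md ml G →
            (v1 v2 v3 : Fin n) → LightSimpleTwoStar h G v1 v2 v3 →
            CreatedByValidLSwitching d G v1 v2 v3 →
            lowerBound1 d h mt md ml ≤ℤ + blStar G v1 v2 v3)
lemma4 n d d↓ h _ _ mt md ml =
  bl∅-lowerBound d↓ ,
  λ G inS v1 v2 v3 (light , _) _ → blStar-lowerBound d↓ G inS v2 v3 light
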